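{- For any integers $t$ and $t'$ such that $2\le t'<t$, $$\dim(P_t\boxtimes P_{t'})=\left\lceil\frac{t+t'-2}{t'-1}\right\rceil.$$
   Context: $P_n$ is the path on $n$ vertices. For a connected graph $X$, a set $S\subseteq V(X)$ is a metric generator if for every two distinct vertices $x,y$ there is $s\in S$ with $d_X(s,x)\ne d_X(s,y)$; the metric dimension $\dim(X)$ is the minimum cardinality of a metric generator. The strong product $P_t\boxtimes P_{t'}$ has vertex set $V(P_t)\times V(P_{t'})$, with $(a,b)\sim(c,d)$ iff ($a=c$ and $b\sim d$) or ($b=d$ and $a\sim c$) or ($a\sim c$ and $b\sim d$). -}

module Defs where

open import Level using (Level; _⊔_) renaming (suc to lsuc)
open import Data.Nat using (ℕ; zero; suc; _+_; _∸_; _<_; NonZero)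
open import Data.Nat.DivMod using (_/_)
open import Data.Fin using (Fin; toℕ)
open import Data.Product using (Σ; ∃; _×_; _,_)
open import Data.List using (List; length)
open import Data.List.Membership.Propositional using (_∈_)
open import Data.List.Relation.Unary.Unique.Propositional using (Unique)
open import Relation.Binary.PropositionalEquality using (_≡_; _≢_)
open import Relation.Nullary using (¬_)

record Graph : Set₁ where
  field
    V   : Set
    Adj : V → V → Set
open Graph public

data Walk (G : Graph) : V G → V G → ℕ → Set where
  nil  : ∀ {x} → Walk G x x 0
  cons : ∀ {x y z k} → Adj G x y → Walk G y z k → Walk G x z (suc k)

Dist : (G : Graph) → V G → V G → ℕ → Set
Dist G x y k = Walk G x y k × (∀ j → j < k → ¬ Walk G x y j)

Connected : Graph → Set
Connected G = ∀ x y → ∃ λ k → Walk G x y k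

IsMetricGenerator : (G : Graph) → List (V G) → Set
IsMetricGenerator G S =
  ∀ x y → x ≢ y → Σ (V G) λ s → s ∈ S × Σ ℕ λ k → Σ ℕ λ k' →
    Dist G s x k × Dist G s y k' × k ≢ k'

MetricDim : (G : Graph) → ℕ → Set
MetricDim G m =
  (Σ (List (V G)) λ S → Unique S × IsMetricGenerator G S × length S ≡ m)
  × (∀ S → Unique S → IsMetricGenerator G S → m Data.Nat.≤ length S)

PathAdj : ∀ {n} → Fin n → Fin n → Set
PathAdj i j = (suc (toℕ i) ≡ toℕ j) Data.Sum.⊎ (suc (toℕ j) ≡ toℕ i)
  where import Data.Sum

_⊠_ : Graph → Graph → Graph
G ⊠ H = record
  { V   = V G × V H
  ; Adj = λ { (a , b) (c , d) →
        ((a ≡ c) × Adj H b d)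
      ⊎ ((Adj G a c × (b ≡ d))
      ⊎ (Adj G a c × Adj H b d)) }
  }
  where open import Data.Sum using (_⊎_)

P : ℕ → Graph
P n = record { V = Fin n ; Adj = PathAdj }

⌈_/_⌉ : ℕ → (b : ℕ) → .{{NonZero b}} → ℕ
⌈ a / b ⌉ = (a + (b ∸ 1)) / b

pred-nonZero : ∀ {n} → 2 Data.Nat.≤ n → NonZero (n ∸ 1)
pred-nonZero (Data.Nat.s≤s (Data.Nat.s≤s _)) = _

-- Distances in P_t ⊠ P_t′ are Chebyshev distances; write the vertices as (x, y) with x ≤ L = t − 1 and
-- y ≤ n = t′ − 1.
--
-- In each column z, all n pairs (z, e), (z, e + 1) must be separated, and a landmark at
-- horizontal distance h from z separates at most n ∸ h of them. So the tents z ↦ n ∸ ∣a − z∣ of the landmark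
-- columns a add up to at least n over every column. Write L = m n + r with r < n and sample the columns
-- along r, r + n, …, L and along 0, r + n, …, L: each tent contributes at most 2n to the two samples, and
-- a landmark covering column 0 (so a < n) contributes at most 2n − r. Hence 2(m + 1)n + r ≤ 2n∣S∣,
-- i.e. L + n ≤ n∣S∣.
--
-- Put ⌈(L + n)/n⌉ landmarks in the columns min(i n, L), alternately in rows 0 and n. The
-- first three of them determine the column of a vertex, and the two consecutive landmarks whose columns
-- enclose it then determine its row.

module Submission where

open import Defs
open import Data.Nat using (ℕ; zero; suc; _+_; _*_; _∸_; _≤_; _<_; _⊔_; _⊓_; ∣_-_∣; z≤n; s≤s; s≤s⁻¹; _≟_; _≤?_; _<?_)
open import Data.Nat.Properties
open import Data.Nat.DivMod using (_/_; _%_; m≡m%n+[m/n]*n; m%n<n; m/n*n≤m)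
open import Data.Nat.ListAction using (sum)
open import Data.Nat.Solver using (module +-*-Solver)
open import Algebra.Properties.CommutativeSemigroup +-commutativeSemigroup using (interchange; xy∙z≈xz∙y)
open import Data.Fin using (Fin; zero; suc; toℕ; fromℕ<; inject₁)
open import Data.Fin.Properties using (toℕ-fromℕ<; toℕ-inject₁; toℕ-injective; toℕ<n)
open import Data.List using (List; []; _∷_; map; length; tabulate)
open import Data.List.Properties using (length-tabulate)
open import Data.List.Membership.Propositional using (_∈_; find)
open import Data.List.Membership.Propositional.Properties using (∈-tabulate⁺)
open import Data.List.Relation.Unary.Any using (here; there)
open import Data.List.Relation.Unary.All using (all?; lookup)
open import Data.List.Relation.Unary.All.Properties using (¬All⇒Any¬)
open import Data.List.Relation.Unary.Unique.Propositional.Properties using (tabulate⁺)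
open import Data.Product using (∃; _×_; _,_; proj₁; proj₂)
open import Data.Sum using (_⊎_; inj₁; inj₂)
open import Function using (_∘_)
open import Relation.Binary using (tri<; tri≈; tri>)
open import Relation.Binary.PropositionalEquality
open import Relation.Nullary using (contradiction; yes; no)

module _ {G : Graph} where

  Walk-snoc : ∀ {x y z k} → Walk G x y k → Adj G y z → Walk G x z (suc k)
  Walk-snoc nil        e′ = cons e′ nil
  Walk-snoc (cons e w) e′ = cons e (Walk-snoc w e′)

  Walk-reverse : (∀ {x y} → Adj G x y → Adj G y x) → ∀ {x y k} → Walk G x y k → Walk G y x k
  Walk-reverse sym nil        = nil
  Walk-reverse sym (cons e w) = Walk-snoc (Walk-reverse sym w) (sym e)

PathAdj-sym : ∀ {n} {i j : Fin n} → PathAdj i j → PathAdj j i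
PathAdj-sym (inj₁ e) = inj₂ e
PathAdj-sym (inj₂ e) = inj₁ e

Walk-suc : ∀ {n} {i j : Fin n} {k} → Walk (P n) i j k → Walk (P (suc n)) (suc i) (suc j) k
Walk-suc nil               = nil
Walk-suc (cons (inj₁ e) w) = cons (inj₁ (cong suc e)) (Walk-suc w)
Walk-suc (cons (inj₂ e) w) = cons (inj₂ (cong suc e)) (Walk-suc w)

walk-from-zero : ∀ {n} (j : Fin (suc n)) → Walk (P (suc n)) zero j (toℕ j)
walk-from-zero zero          = nil
walk-from-zero (suc zero)    = cons (inj₁ refl) nil
walk-from-zero (suc (suc j)) = cons (inj₁ refl) (Walk-suc (walk-from-zero (suc j)))

path-walk : ∀ {n} (i j : Fin n) → Walk (P n) i j ∣ toℕ i - toℕ j ∣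
path-walk zero    j       = walk-from-zero j
path-walk (suc i) zero    = Walk-reverse PathAdj-sym (walk-from-zero (suc i))
path-walk (suc i) (suc j) = Walk-suc (path-walk i j)

module _ {t u : ℕ} where

  Walk-⊠ˡ : ∀ {a c : Fin t} {b : Fin u} {k} → Walk (P t) a c k → Walk (P t ⊠ P u) (a , b) (c , b) k
  Walk-⊠ˡ nil        = nil
  Walk-⊠ˡ (cons e w) = cons (inj₂ (inj₁ (e , refl))) (Walk-⊠ˡ w)

  Walk-⊠ʳ : ∀ {a : Fin t} {b d : Fin u} {k} → Walk (P u) b d k → Walk (P t ⊠ P u) (a , b) (a , d) k
  Walk-⊠ʳ nil        = nil
  Walk-⊠ʳ (cons e w) = cons (inj₁ (refl , e)) (Walk-⊠ʳ w)

  Walk-⊠ : ∀ {a c : Fin t} {b d : Fin u} {k l} →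
           Walk (P t) a c k → Walk (P u) b d l → Walk (P t ⊠ P u) (a , b) (c , d) (k ⊔ l)
  Walk-⊠ nil           w′           = Walk-⊠ʳ w′
  Walk-⊠ w@(cons _ _)  nil          = Walk-⊠ˡ w
  Walk-⊠ (cons e w)    (cons e′ w′) = cons (inj₂ (inj₂ (e , e′))) (Walk-⊠ w w′)

chebyshev : ∀ {t u} → Fin t × Fin u → Fin t × Fin u → ℕ
chebyshev (a , b) (c , d) = ∣ toℕ a - toℕ c ∣ ⊔ ∣ toℕ b - toℕ d ∣

∣m-1+m∣≡1 : ∀ m → ∣ m - suc m ∣ ≡ 1
∣m-1+m∣≡1 zero    = refl
∣m-1+m∣≡1 (suc m) = ∣m-1+m∣≡1 m

PathAdj⇒∣-∣≡1 : ∀ {n} {i j : Fin n} → PathAdj i j → ∣ toℕ i - toℕ j ∣ ≡ 1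
PathAdj⇒∣-∣≡1 {i = i} (inj₁ e) = subst (λ m → ∣ toℕ i - m ∣ ≡ 1) e (∣m-1+m∣≡1 (toℕ i))
PathAdj⇒∣-∣≡1 {j = j} (inj₂ e) = subst (λ m → ∣ m - toℕ j ∣ ≡ 1) e
  (trans (∣-∣-comm (suc (toℕ j)) (toℕ j)) (∣m-1+m∣≡1 (toℕ j)))

∣i-i∣≤1 : ∀ {n} (i : Fin n) → ∣ toℕ i - toℕ i ∣ ≤ 1
∣i-i∣≤1 i = ≤-trans (≤-reflexive (∣n-n∣≡0 (toℕ i))) z≤n

PathAdj⇒∣-∣≤1 : ∀ {n} {i j : Fin n} → PathAdj i j → ∣ toℕ i - toℕ j ∣ ≤ 1
PathAdj⇒∣-∣≤1 e = ≤-reflexive (PathAdj⇒∣-∣≡1 e)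

⊠-Adj⇒chebyshev≤1 : ∀ {t u} {v w : Fin t × Fin u} → Adj (P t ⊠ P u) v w → chebyshev v w ≤ 1
⊠-Adj⇒chebyshev≤1 {v = a , _} (inj₁ (refl , e))        = ⊔-lub (∣i-i∣≤1 a) (PathAdj⇒∣-∣≤1 e)
⊠-Adj⇒chebyshev≤1 {v = _ , b} (inj₂ (inj₁ (e , refl))) = ⊔-lub (PathAdj⇒∣-∣≤1 e) (∣i-i∣≤1 b)
⊠-Adj⇒chebyshev≤1 (inj₂ (inj₂ (e , e′)))             = ⊔-lub (PathAdj⇒∣-∣≤1 e) (PathAdj⇒∣-∣≤1 e′)

chebyshev-triangle : ∀ {t u} (v w x : Fin t × Fin u) → chebyshev v x ≤ chebyshev v w + chebyshev w x
chebyshev-triangle (a , b) (c , d) (e , f) = ⊔-lub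
  (≤-trans (∣-∣-triangle (toℕ a) (toℕ c) (toℕ e)) (+-mono-≤ (m≤m⊔n ac bd) (m≤m⊔n ce df)))
  (≤-trans (∣-∣-triangle (toℕ b) (toℕ d) (toℕ f)) (+-mono-≤ (m≤n⊔m ac bd) (m≤n⊔m ce df)))
  where
  ac = ∣ toℕ a - toℕ c ∣
  bd = ∣ toℕ b - toℕ d ∣
  ce = ∣ toℕ c - toℕ e ∣
  df = ∣ toℕ d - toℕ f ∣

chebyshev-≤-length : ∀ {t u} {v w : Fin t × Fin u} {k} → Walk (P t ⊠ P u) v w k → chebyshev v w ≤ k
chebyshev-≤-length {v = a , b} nil = ≤-reflexive (cong₂ _⊔_ (∣n-n∣≡0 (toℕ a)) (∣n-n∣≡0 (toℕ b)))
chebyshev-≤-length {v = v} {w} (cons {y = x} e walk) = begin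
  chebyshev v w                 ≤⟨ chebyshev-triangle v x w ⟩
  chebyshev v x + chebyshev x w ≤⟨ +-mono-≤ (⊠-Adj⇒chebyshev≤1 e) (chebyshev-≤-length walk) ⟩
  suc _                         ∎
  where open ≤-Reasoning

chebyshev-Dist : ∀ {t u} (v w : Fin t × Fin u) → Dist (P t ⊠ P u) v w (chebyshev v w)
chebyshev-Dist (a , b) (c , d) =
  Walk-⊠ (path-walk a c) (path-walk b d) , λ j j<d walk → <⇒≱ j<d (chebyshev-≤-length walk)

Dist⇒≡chebyshev : ∀ {t u} {v w : Fin t × Fin u} {k} → Dist (P t ⊠ P u) v w k → k ≡ chebyshev v w
Dist⇒≡chebyshev {v = v} {w} {k} (walk , shortest) with <-cmp k (chebyshev v w)
... | tri< k<d _ _ = contradiction (chebyshev-≤-length walk) (<⇒≱ k<d)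
... | tri≈ _ k≡d _ = k≡d
... | tri> _ _ d<k = contradiction (proj₁ (chebyshev-Dist v w)) (shortest _ d<k)

module _ {t u : ℕ} (S : List (Fin t × Fin u)) where

  generator⇒separates : IsMetricGenerator (P t ⊠ P u) S → ∀ {v w} → v ≢ w →
                        ∃ λ s → s ∈ S × chebyshev s v ≢ chebyshev s w
  generator⇒separates gen {v} {w} v≢w with gen v w v≢w
  ... | s , s∈S , k , l , dist-v , dist-w , k≢l =
    s , s∈S , λ eq → k≢l (trans (Dist⇒≡chebyshev dist-v) (trans eq (sym (Dist⇒≡chebyshev dist-w))))

  separating⇒generator : (∀ v w → (∀ {s} → s ∈ S → chebyshev s v ≡ chebyshev s w) → v ≡ w) →
                         IsMetricGenerator (P t ⊠ P u) S
  separating⇒generator separating v w v≢w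
    with all? (λ s → chebyshev s v ≟ chebyshev s w) S
  ... | yes same = contradiction (separating v w (lookup same)) v≢w
  ... | no ¬same with find (¬All⇒Any¬ (λ s → chebyshev s v ≟ chebyshev s w) S ¬same)
  ...   | s , s∈S , differ = s , s∈S , _ , _ , chebyshev-Dist s v , chebyshev-Dist s w , differ

module _ {A : Set} where

  sum-map-+ : ∀ (f g : A → ℕ) xs → sum (map (λ x → f x + g x) xs) ≡ sum (map f xs) + sum (map g xs)
  sum-map-+ f g []       = refl
  sum-map-+ f g (x ∷ xs) =
    trans (cong (f x + g x +_) (sum-map-+ f g xs)) (interchange (f x) (g x) _ _)

  sum-map-mono : ∀ {f g : A → ℕ} → (∀ x → f x ≤ g x) → ∀ xs → sum (map f xs) ≤ sum (map g xs)
  sum-map-mono f≤g []       = z≤n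
  sum-map-mono f≤g (x ∷ xs) = +-mono-≤ (f≤g x) (sum-map-mono f≤g xs)

  ∈⇒≤sum-map : ∀ (f : A → ℕ) {x xs} → x ∈ xs → f x ≤ sum (map f xs)
  ∈⇒≤sum-map f (here refl)  = m≤m+n _ _
  ∈⇒≤sum-map f (there x∈xs) = ≤-trans (∈⇒≤sum-map f x∈xs) (m≤n+m _ _)

  sum-map-pos : ∀ (f : A → ℕ) xs → 0 < sum (map f xs) → ∃ λ x → x ∈ xs × 0 < f x
  sum-map-pos f (x ∷ xs) pos with f x in fx
  ... | suc _ = x , here refl , subst (0 <_) (sym fx) (s≤s z≤n)
  ... | zero with sum-map-pos f xs pos
  ...   | y , y∈xs , fy>0 = y , there y∈xs , fy>0

  sum-map-≤-length* : ∀ {f : A → ℕ} {B} → (∀ x → f x ≤ B) → ∀ xs → sum (map f xs) ≤ length xs * B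
  sum-map-≤-length* f≤B []       = z≤n
  sum-map-≤-length* f≤B (x ∷ xs) = +-mono-≤ (f≤B x) (sum-map-≤-length* f≤B xs)

  sum-map+slack-≤-length* : ∀ {f : A → ℕ} {B r x xs} → (∀ x → f x ≤ B) → x ∈ xs → f x + r ≤ B →
                            sum (map f xs) + r ≤ length xs * B
  sum-map+slack-≤-length* {f} {B} {r} f≤B (here {x = x} {xs = xs} refl) slack = begin
    f x + sum (map f xs) + r ≡⟨ xy∙z≈xz∙y (f x) _ r ⟩
    f x + r + sum (map f xs) ≤⟨ +-mono-≤ slack (sum-map-≤-length* f≤B xs) ⟩
    B + length xs * B        ∎
    where open ≤-Reasoning
  sum-map+slack-≤-length* {f} {B} {r} f≤B (there {x = y} x∈xs) slack =
    ≤-trans (≤-reflexive (+-assoc (f y) _ r)) (+-mono-≤ (f≤B y) (sum-map+slack-≤-length* f≤B x∈xs slack))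

tent : ℕ → ℕ → ℕ → ℕ
tent n a z = n ∸ ∣ a - z ∣

gridSum : ℕ → ℕ → ℕ → ℕ → ℕ
gridSum n a c zero    = 0
gridSum n a c (suc K) = tent n a c + gridSum n a (c + n) K

m+n≤o⇒n≤∣m-o∣ : ∀ {m n o} → m + n ≤ o → n ≤ ∣ m - o ∣
m+n≤o⇒n≤∣m-o∣ {m} {n} {o} m+n≤o = begin
  n         ≤⟨ m+n≤o⇒m≤o∸n n (subst (_≤ o) (+-comm m n) m+n≤o) ⟩
  o ∸ m     ≤⟨ m∸n≤∣m-n∣ o m ⟩
  ∣ o - m ∣ ≡⟨ ∣-∣-comm o m ⟩
  ∣ m - o ∣ ∎
  where open ≤-Reasoning

tent-vanishesʳ : ∀ {n a c} → a + n ≤ c → tent n a c ≡ 0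
tent-vanishesʳ {n} {a} {c} a+n≤c = m≤n⇒m∸n≡0 (m+n≤o⇒n≤∣m-o∣ {a} {n} {c} a+n≤c)

tent-vanishesˡ : ∀ {n a c} → c + n ≤ a → tent n a c ≡ 0
tent-vanishesˡ {n} {a} {c} c+n≤a = m≤n⇒m∸n≡0 (subst (_ ≤_) (∣-∣-comm c a) (m+n≤o⇒n≤∣m-o∣ {c} {n} {a} c+n≤a))

gridSum-vanishes : ∀ {n a c} K → a + n ≤ c → gridSum n a c K ≡ 0
gridSum-vanishes zero    a+n≤c = refl
gridSum-vanishes {n} {a} {c} (suc K) a+n≤c =
  cong₂ _+_ (tent-vanishesʳ {n} {a} a+n≤c) (gridSum-vanishes K (≤-trans a+n≤c (m≤m+n c n)))

gridSum-≤-tent : ∀ {n a c} K → a ≤ c → gridSum n a c K ≤ tent n a c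
gridSum-≤-tent zero    a≤c = z≤n
gridSum-≤-tent {n} {a} {c} (suc K) a≤c =
  ≤-reflexive (trans (cong (tent n a c +_) (gridSum-vanishes {n} {a} K (+-monoˡ-≤ n a≤c))) (+-identityʳ _))

[n∸x]+[n∸y]≤n : ∀ {n x y} → n ≤ x + y → (n ∸ x) + (n ∸ y) ≤ n
[n∸x]+[n∸y]≤n {n} {x} {y} n≤x+y with x ≤? n
... | yes x≤n = begin
  (n ∸ x) + (n ∸ y) ≤⟨ +-monoʳ-≤ (n ∸ x) (m≤n+o⇒m∸n≤o n y (subst (n ≤_) (+-comm x y) n≤x+y)) ⟩
  (n ∸ x) + x       ≡⟨ m∸n+n≡m x≤n ⟩
  n                 ∎
  where open ≤-Reasoning
... | no x≰n = subst (_≤ n) (cong (_+ (n ∸ y)) (sym (m≤n⇒m∸n≡0 (<⇒≤ (≰⇒> x≰n))))) (m∸n≤m n y)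

tent-pair≤ : ∀ {n a c c′} → c + n ≤ c′ → tent n a c + tent n a c′ ≤ n
tent-pair≤ {n} {a} {c} {c′} c+n≤c′ = [n∸x]+[n∸y]≤n {n} {∣ a - c ∣} {∣ a - c′ ∣} (begin
  n                         ≤⟨ m+n≤o⇒n≤∣m-o∣ c+n≤c′ ⟩
  ∣ c - c′ ∣                ≤⟨ ∣-∣-triangle c a c′ ⟩
  ∣ c - a ∣ + ∣ a - c′ ∣    ≡⟨ cong (_+ ∣ a - c′ ∣) (∣-∣-comm c a) ⟩
  ∣ a - c ∣ + ∣ a - c′ ∣    ∎)
  where open ≤-Reasoning

-- Sample points at distance at least n apart see each tent of width n at most once in total.
tent+gridSum≤ : ∀ {n a c c′} K → c + n ≤ c′ → tent n a c + gridSum n a c′ K ≤ n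
tent+gridSum≤ {n} {a} {c} zero c+n≤c′ = ≤-trans (≤-reflexive (+-identityʳ _)) (m∸n≤m n ∣ a - c ∣)
tent+gridSum≤ {n} {a} {c} {c′} (suc K) c+n≤c′ with a ≤? c′
... | yes a≤c′ = begin
  tent n a c + (tent n a c′ + gridSum n a (c′ + n) K) ≡⟨ cong (λ g → tent n a c + (tent n a c′ + g)) rest≡0 ⟩
  tent n a c + (tent n a c′ + 0)                      ≡⟨ cong (tent n a c +_) (+-identityʳ _) ⟩
  tent n a c + tent n a c′                            ≤⟨ tent-pair≤ {n} {a} c+n≤c′ ⟩
  n                                                   ∎
  where
  open ≤-Reasoning
  rest≡0 : gridSum n a (c′ + n) K ≡ 0
  rest≡0 = gridSum-vanishes {n} {a} K (+-monoˡ-≤ n a≤c′)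
... | no a≰c′ =
  subst (_≤ n) (cong (_+ gridSum n a c′ (suc K)) (sym (tent-vanishesˡ {n} {a} (≤-trans c+n≤c′ (<⇒≤ (≰⇒> a≰c′))))))
    (tent+gridSum≤ {n} {a} K ≤-refl)

n∸∣d-n∣≤d : ∀ n d → n ∸ ∣ d - n ∣ ≤ d
n∸∣d-n∣≤d n d = m≤n+o⇒m∸n≤o n ∣ d - n ∣ (subst (n ≤_) (+-comm d _) (m≤n+∣n-m∣ n d))

-- Columns are sampled along r, r + n, …, r + m n and along 0, r + n, …, r + m n.
doubleGridSum : ℕ → ℕ → ℕ → ℕ → ℕ
doubleGridSum n r m a = gridSum n a r (suc m) + (tent n a 0 + gridSum n a (r + n) m)

doubleGridSum≤ : ∀ {n} r m a → doubleGridSum n r m a ≤ n + n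
doubleGridSum≤ {n} r m a =
  +-mono-≤ (tent+gridSum≤ {n} {a} m ≤-refl) (tent+gridSum≤ {n} {a} m (m≤n+m n r))

doubleGridSum+r≤-rightOf : ∀ {n} r d m → r + d < n → doubleGridSum n r m (r + d) + r ≤ n + n
doubleGridSum+r≤-rightOf {n} r d m r+d<n = begin
  (tent n (r + d) r + g) + (tent n (r + d) 0 + g) + r ≡⟨ +-assoc (tent n (r + d) r + g) _ r ⟩
  (tent n (r + d) r + g) + (tent n (r + d) 0 + g + r) ≤⟨ +-mono-≤ (tent+gridSum≤ {n} {r + d} m ≤-refl) near-zero ⟩
  n + n                                               ∎
  where
  open ≤-Reasoning
  g = gridSum n (r + d) (r + n) m
  g≤d : g ≤ d
  g≤d = begin
    g                          ≤⟨ gridSum-≤-tent {n} {r + d} m (+-monoʳ-≤ r (≤-trans (m≤n+m d r) (<⇒≤ r+d<n))) ⟩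
    n ∸ ∣ r + d - r + n ∣      ≡⟨ cong (n ∸_) (∣m+n-m+o∣≡∣n-o∣ r d n) ⟩
    n ∸ ∣ d - n ∣              ≤⟨ n∸∣d-n∣≤d n d ⟩
    d                          ∎
  near-zero : tent n (r + d) 0 + g + r ≤ n
  near-zero = begin
    n ∸ ∣ r + d - 0 ∣ + g + r  ≡⟨ cong (λ x → n ∸ x + g + r) (∣-∣-identityʳ (r + d)) ⟩
    n ∸ (r + d) + g + r        ≤⟨ +-monoˡ-≤ r (+-monoʳ-≤ (n ∸ (r + d)) g≤d) ⟩
    n ∸ (r + d) + d + r        ≡⟨ +-assoc (n ∸ (r + d)) d r ⟩
    n ∸ (r + d) + (d + r)      ≡⟨ cong (n ∸ (r + d) +_) (+-comm d r) ⟩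
    n ∸ (r + d) + (r + d)      ≡⟨ m∸n+n≡m (<⇒≤ r+d<n) ⟩
    n                          ∎

doubleGridSum+r≤-leftOf : ∀ {n} a d m → a < n → a + d ≤ n → doubleGridSum n (a + d) m a + (a + d) ≤ n + n
doubleGridSum+r≤-leftOf {n} a d m a<n a+d≤n = begin
  (tent n a (a + d) + g) + (tent n a 0 + g) + (a + d) ≡⟨ cong₂ (λ x y → (x + g) + (y + g) + (a + d)) tent-at-r tent-at-0 ⟩
  (n ∸ d + g) + (n ∸ a + g) + (a + d)                 ≡⟨ cong (λ z → (n ∸ d + z) + (n ∸ a + z) + (a + d)) g≡0 ⟩
  (n ∸ d + 0) + (n ∸ a + 0) + (a + d)                 ≡⟨ rearrange (n ∸ d) (n ∸ a) a d ⟩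
  (n ∸ d + d) + (n ∸ a + a)                           ≡⟨ cong₂ _+_ (m∸n+n≡m d≤n) (m∸n+n≡m (<⇒≤ a<n)) ⟩
  n + n                                               ∎
  where
  open ≤-Reasoning
  g = gridSum n a (a + d + n) m
  g≡0 : g ≡ 0
  g≡0 = gridSum-vanishes {n} {a} m (+-monoˡ-≤ n (m≤m+n a d))
  tent-at-r : tent n a (a + d) ≡ n ∸ d
  tent-at-r = cong (n ∸_) (∣m-m+n∣≡n a d)
  tent-at-0 : tent n a 0 ≡ n ∸ a
  tent-at-0 = cong (n ∸_) (∣-∣-identityʳ a)
  d≤n : d ≤ n
  d≤n = ≤-trans (m≤n+m d a) a+d≤n
  rearrange : ∀ x y a d → (x + 0) + (y + 0) + (a + d) ≡ (x + d) + (y + a)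
  rearrange = solve 4 (λ x y a d → (x :+ con 0) :+ (y :+ con 0) :+ (a :+ d) := (x :+ d) :+ (y :+ a)) refl
    where open +-*-Solver

doubleGridSum+r≤ : ∀ {n} r m a → a < n → r ≤ n → doubleGridSum n r m a + r ≤ n + n
doubleGridSum+r≤ {n} r m a a<n r≤n with ≤-total r a
... | inj₁ r≤a = let d , r+d≡a = m≤n⇒∃[o]m+o≡n r≤a in
  subst (λ a → doubleGridSum n r m a + r ≤ n + n) r+d≡a
    (doubleGridSum+r≤-rightOf r d m (subst (_< n) (sym r+d≡a) a<n))
... | inj₂ a≤r = let d , a+d≡r = m≤n⇒∃[o]m+o≡n a≤r in
  subst (λ r → doubleGridSum n r m a + r ≤ n + n) a+d≡r
    (doubleGridSum+r≤-leftOf a d m a<n (subst (_≤ n) (sym a+d≡r) r≤n))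

∣-∣≤ : ∀ {m n h} → m ≤ n + h → n ≤ m + h → ∣ m - n ∣ ≤ h
∣-∣≤ {m} {n} m≤n+h n≤m+h with ∣m-n∣≡[m∸n]∨[n∸m] m n
... | inj₁ eq = subst (_≤ _) (sym eq) (m≤n+o⇒m∸n≤o m n m≤n+h)
... | inj₂ eq = subst (_≤ _) (sym eq) (m≤n+o⇒m∸n≤o n m n≤m+h)

vertical-separation : ∀ h b e → h ⊔ ∣ b - e ∣ ≢ h ⊔ ∣ b - suc e ∣ → e + h < b ⊎ b + h ≤ e
vertical-separation h b e differ with e + h <? b | b + h ≤? e
... | yes below | _         = inj₁ below
... | no _      | yes above = inj₂ above
... | no ¬below | no ¬above = contradiction (trans (m≥n⇒m⊔n≡m close) (sym (m≥n⇒m⊔n≡m close′))) differ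
  where
  b≤e+h : b ≤ e + h
  b≤e+h = ≮⇒≥ ¬below
  e<b+h : e < b + h
  e<b+h = ≰⇒> ¬above
  close : ∣ b - e ∣ ≤ h
  close = ∣-∣≤ b≤e+h (<⇒≤ e<b+h)
  close′ : ∣ b - suc e ∣ ≤ h
  close′ = ∣-∣≤ (≤-trans b≤e+h (n≤1+n _)) e<b+h

interval-cover : ∀ {n} A Γ → (∀ (i : Fin n) → toℕ i < A ⊎ n ∸ Γ ≤ toℕ i) → n ≤ A + Γ
interval-cover {n} A Γ covered with n ≤? A
... | yes n≤A = ≤-trans n≤A (m≤m+n A Γ)
... | no n≰A with covered (fromℕ< (≰⇒> n≰A))
...   | inj₁ A<A  = contradiction (subst (_< A) (toℕ-fromℕ< _) A<A) (<-irrefl refl)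
...   | inj₂ n∸Γ≤ = begin
  n           ≤⟨ m≤n+m∸n n Γ ⟩
  Γ + (n ∸ Γ) ≤⟨ +-monoʳ-≤ Γ (subst (n ∸ Γ ≤_) (toℕ-fromℕ< _) n∸Γ≤) ⟩
  Γ + A       ≡⟨ +-comm Γ A ⟩
  A + Γ       ∎
  where open ≤-Reasoning

m∸[m∸n]≤n : ∀ m n → m ∸ (m ∸ n) ≤ n
m∸[m∸n]≤n m n = m≤n+o⇒m∸n≤o m (m ∸ n) (subst (m ≤_) (+-comm n (m ∸ n)) (m≤n+m∸n m n))

[b∸h]+[n∸[b+h]]≤n∸h : ∀ {n b} h → b ≤ n → (b ∸ h) + (n ∸ (b + h)) ≤ n ∸ h
[b∸h]+[n∸[b+h]]≤n∸h {n} {b} h b≤n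
  rewrite +-comm b h | sym (∸-+-assoc n h b) with b ≤? n ∸ h
... | yes b≤n∸h = ≤-trans (+-monoˡ-≤ _ (m∸n≤m b h)) (≤-reflexive (m+[n∸m]≡n b≤n∸h))
... | no b≰n∸h  = begin
  (b ∸ h) + (n ∸ h ∸ b) ≡⟨ cong ((b ∸ h) +_) (m≤n⇒m∸n≡0 (<⇒≤ (≰⇒> b≰n∸h))) ⟩
  (b ∸ h) + 0           ≡⟨ +-identityʳ _ ⟩
  b ∸ h                 ≤⟨ ∸-monoˡ-≤ h b≤n ⟩
  n ∸ h                 ∎
  where open ≤-Reasoning

module _ {t n : ℕ} {S : List (Fin t × Fin (suc n))} (gen : IsMetricGenerator (P t ⊠ P (suc n)) S) where

  column-coverage : ∀ (z : Fin t) → n ≤ sum (map (λ s → tent n (toℕ (proj₁ s)) (toℕ z)) S)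
  column-coverage z = begin
    n                                     ≤⟨ interval-cover (sum (map below S)) (sum (map above S)) covered ⟩
    sum (map below S) + sum (map above S) ≡⟨ sum-map-+ below above S ⟨
    sum (map (λ s → below s + above s) S) ≤⟨ sum-map-mono (λ s → [b∸h]+[n∸[b+h]]≤n∸h (offset s) (height≤n s)) S ⟩
    sum (map (λ s → tent n (toℕ (proj₁ s)) (toℕ z)) S) ∎
    where
    open ≤-Reasoning
    offset height below above : Fin t × Fin (suc n) → ℕ
    offset s = ∣ toℕ (proj₁ s) - toℕ z ∣
    height s = toℕ (proj₂ s)
    below  s = height s ∸ offset s
    above  s = n ∸ (height s + offset s)
    height≤n : ∀ s → height s ≤ n
    height≤n s = s≤s⁻¹ (toℕ<n (proj₂ s))
    covered : ∀ (i : Fin n) → toℕ i < sum (map below S) ⊎ n ∸ sum (map above S) ≤ toℕ i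
    covered i with generator⇒separates S gen {z , inject₁ i} {z , suc i}
                     (λ eq → <-irrefl (cong (toℕ ∘ proj₂) eq) (subst (_< suc (toℕ i)) (sym (toℕ-inject₁ i)) ≤-refl))
    ... | s , s∈S , differ
      with vertical-separation (offset s) (height s) (toℕ i)
             (subst (λ e → offset s ⊔ ∣ height s - e ∣ ≢ offset s ⊔ ∣ height s - suc (toℕ i) ∣) (toℕ-inject₁ i) differ)
    ...   | inj₁ i+h<b = inj₁ (≤-trans (m+n≤o⇒m≤o∸n (suc (toℕ i)) i+h<b) (∈⇒≤sum-map below s∈S))
    ...   | inj₂ b+h≤i = inj₂ (begin
      n ∸ sum (map above S) ≤⟨ ∸-monoʳ-≤ n (∈⇒≤sum-map above s∈S) ⟩
      n ∸ above s           ≤⟨ m∸[m∸n]≤n n _ ⟩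
      height s + offset s   ≤⟨ b+h≤i ⟩
      toℕ i                 ∎)

module _ {A : Set} (xs : List A) (col : A → ℕ) {n L : ℕ}
         (covered : ∀ z → z ≤ L → n ≤ sum (map (λ x → tent n (col x) z) xs)) where

  gridSum-coverage : ∀ c K → c + K * n ≤ L + n → K * n ≤ sum (map (λ x → gridSum n (col x) c K) xs)
  gridSum-coverage c zero    _     = z≤n
  gridSum-coverage c (suc K) bound = begin
    n + K * n                                        ≤⟨ +-mono-≤ (covered c c≤L) (gridSum-coverage (c + n) K next) ⟩
    sum (map first xs) + sum (map rest xs)           ≡⟨ sum-map-+ first rest xs ⟨
    sum (map (λ x → gridSum n (col x) c (suc K)) xs) ∎
    where
    open ≤-Reasoning
    first rest : A → ℕ
    first x = tent n (col x) c
    rest  x = gridSum n (col x) (c + n) K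
    next : c + n + K * n ≤ L + n
    next = subst (_≤ L + n) (sym (+-assoc c n (K * n))) bound
    c≤L : c ≤ L
    c≤L = +-cancelʳ-≤ n c L (≤-trans (+-monoʳ-≤ c (m≤m+n n (K * n))) bound)

halve-with-remainder : ∀ {q k r n} → q * (n + n) + r ≤ k * (n + n) → r < n → q * n + r ≤ k * n
halve-with-remainder {q} {k} {zero} {n@(suc _)} le _ =
  subst (_≤ k * n) (sym (+-identityʳ _))
    (*-monoˡ-≤ n (*-cancelʳ-≤ q k (n + n) (subst (_≤ k * (n + n)) (+-identityʳ _) le)))
halve-with-remainder {q} {k} {suc r} {n} le r<n = begin
  q * n + suc r ≤⟨ +-monoʳ-≤ (q * n) (<⇒≤ r<n) ⟩
  q * n + n     ≡⟨ +-comm (q * n) n ⟩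
  suc q * n     ≤⟨ *-monoˡ-≤ n (*-cancelʳ-< (n + n) q k q[n+n]<k[n+n]) ⟩
  k * n         ∎
  where
  open ≤-Reasoning
  q[n+n]<k[n+n] : q * (n + n) < k * (n + n)
  q[n+n]<k[n+n] = ≤-trans (s≤s (m≤m+n (q * (n + n)) r)) (subst (_≤ k * (n + n)) (+-suc (q * (n + n)) r) le)

tent-positive⇒∣-∣< : ∀ {n a z} → 0 < tent n a z → ∣ a - z ∣ < n
tent-positive⇒∣-∣< pos = m∸n≢0⇒n<m (>⇒≢ pos)

lower-bound : ∀ {L n′} {S : List (Fin (suc L) × Fin (suc (suc n′)))} →
              IsMetricGenerator (P (suc L) ⊠ P (suc (suc n′))) S → L + suc n′ ≤ length S * suc n′
lower-bound {L} {n′} {S} gen = begin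
  L + n                    ≡⟨ L+n≡[1+m]*n+r ⟩
  suc m * n + r            ≤⟨ halve-with-remainder {suc m} {length S} (≤-trans (+-monoˡ-≤ r samples) slack) (m%n<n L n) ⟩
  length S * n             ∎
  where
  open ≤-Reasoning
  n = suc n′
  m = L / n
  r = L % n
  col : Fin (suc L) × Fin (suc n) → ℕ
  col s = toℕ (proj₁ s)
  covered : ∀ z → z ≤ L → n ≤ sum (map (λ s → tent n (col s) z) S)
  covered z z≤L = subst (λ z → n ≤ sum (map (λ s → tent n (col s) z) S)) (toℕ-fromℕ< (s≤s z≤L))
                    (column-coverage gen (fromℕ< (s≤s z≤L)))
  L+n≡r+[1+m]*n : L + n ≡ r + suc m * n
  L+n≡r+[1+m]*n = begin-equality
    L + n                ≡⟨ cong (_+ n) (m≡m%n+[m/n]*n L n) ⟩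
    r + m * n + n        ≡⟨ +-assoc r (m * n) n ⟩
    r + (m * n + n)      ≡⟨ cong (r +_) (+-comm (m * n) n) ⟩
    r + suc m * n        ∎
  L+n≡[1+m]*n+r : L + n ≡ suc m * n + r
  L+n≡[1+m]*n+r = trans L+n≡r+[1+m]*n (+-comm r _)
  grid₁ grid₀ grid₂ : Fin (suc L) × Fin (suc n) → ℕ
  grid₁ s = gridSum n (col s) r (suc m)
  grid₀ s = tent n (col s) 0
  grid₂ s = gridSum n (col s) (r + n) m
  samples : suc m * (n + n) ≤ sum (map (λ s → doubleGridSum n r m (col s)) S)
  samples = begin
    suc m * (n + n)                                            ≡⟨ *-distribˡ-+ (suc m) n n ⟩
    suc m * n + (n + m * n)
      ≤⟨ +-mono-≤ grid₁-covered (+-mono-≤ (covered 0 z≤n) grid₂-covered) ⟩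
    sum (map grid₁ S) + (sum (map grid₀ S) + sum (map grid₂ S)) ≡⟨ cong (sum (map grid₁ S) +_) (sum-map-+ grid₀ grid₂ S) ⟨
    sum (map grid₁ S) + sum (map (λ s → grid₀ s + grid₂ s) S)   ≡⟨ sum-map-+ grid₁ (λ s → grid₀ s + grid₂ s) S ⟨
    sum (map (λ s → doubleGridSum n r m (col s)) S)            ∎
    where
    grid₁-covered : suc m * n ≤ sum (map grid₁ S)
    grid₁-covered = gridSum-coverage S col covered r (suc m) (≤-reflexive (sym L+n≡r+[1+m]*n))
    grid₂-covered : m * n ≤ sum (map grid₂ S)
    grid₂-covered = gridSum-coverage S col covered (r + n) m
                      (≤-reflexive (trans (+-assoc r n (m * n)) (sym L+n≡r+[1+m]*n)))
  slack : sum (map (λ s → doubleGridSum n r m (col s)) S) + r ≤ length S * (n + n)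
  slack with sum-map-pos (λ s → tent n (col s) 0) S (≤-trans (s≤s z≤n) (covered 0 z≤n))
  ... | s , s∈S , pos =
    sum-map+slack-≤-length* (λ s → doubleGridSum≤ r m (col s)) s∈S
      (doubleGridSum+r≤ r m (col s) (subst (_< n) (∣-∣-identityʳ (col s)) (tent-positive⇒∣-∣< {n} {col s} pos))
        (<⇒≤ (m%n<n L n)))

⊔-⊓-swap : ∀ {x y x′ y′} → x ⊔ y ≡ x′ ⊔ y′ → x ⊓ y ≡ x′ ⊓ y′ → x ≡ x′ ⊎ (x ≡ y′ × y ≡ x′)
⊔-⊓-swap {x} {y} {x′} {y′} max min with ≤-total x y | ≤-total x′ y′
... | inj₁ x≤y | inj₁ x′≤y′ = inj₁ (trans (sym (m≤n⇒m⊓n≡m x≤y)) (trans min (m≤n⇒m⊓n≡m x′≤y′)))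
... | inj₁ x≤y | inj₂ y′≤x′ = inj₂ (trans (sym (m≤n⇒m⊓n≡m x≤y)) (trans min (m≥n⇒m⊓n≡n y′≤x′)) ,
                                    trans (sym (m≤n⇒m⊔n≡n x≤y)) (trans max (m≥n⇒m⊔n≡m y′≤x′)))
... | inj₂ y≤x | inj₁ x′≤y′ = inj₂ (trans (sym (m≥n⇒m⊔n≡m y≤x)) (trans max (m≤n⇒m⊔n≡n x′≤y′)) ,
                                    trans (sym (m≥n⇒m⊓n≡n y≤x)) (trans min (m≤n⇒m⊓n≡m x′≤y′)))
... | inj₂ y≤x | inj₂ y′≤x′ = inj₁ (trans (sym (m≥n⇒m⊔n≡m y≤x)) (trans max (m≥n⇒m⊔n≡m y′≤x′)))

⊔-<-absorbed : ∀ {h a b} → a < b → h ⊔ a ≡ h ⊔ b → b ≤ h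
⊔-<-absorbed {h} {a} {b} a<b eq with b ≤? h
... | yes b≤h = b≤h
... | no b≰h  = contradiction (trans eq (m≤n⇒m⊔n≡n (<⇒≤ h<b))) (<⇒≢ (⊔-lub h<b a<b))
  where h<b = ≰⇒> b≰h

corner-pair-mixed : ∀ {n x y x′ y′} → y ≤ n → y′ ≤ n → n ≤ x → x′ < n →
  x ⊔ y ≡ x′ ⊔ y′ → ∣ n - x ∣ ⊔ (n ∸ y) ≡ ∣ n - x′ ∣ ⊔ (n ∸ y′) → x ≡ y′ × y ≡ x′
corner-pair-mixed {n} {x} {y} {x′} {y′} y≤n y′≤n n≤x x′<n e₀ e₁ = trans x≡n (sym y′≡n) , y≡x′
  where
  x≡x′⊔y′ : x ≡ x′ ⊔ y′
  x≡x′⊔y′ = trans (sym (m≥n⇒m⊔n≡m (≤-trans y≤n n≤x))) e₀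
  y′≡n : y′ ≡ n
  y′≡n = ≤-antisym y′≤n (≮⇒≥ (λ y′<n → <⇒≱ (⊔-lub x′<n y′<n) (subst (n ≤_) x≡x′⊔y′ n≤x)))
  x≡n : x ≡ n
  x≡n = trans x≡x′⊔y′ (trans (cong (x′ ⊔_) y′≡n) (m≤n⇒m⊔n≡n (<⇒≤ x′<n)))
  y≡x′ : y ≡ x′
  y≡x′ = ∸-cancelˡ-≡ y≤n (<⇒≤ x′<n) (begin
    n ∸ y                   ≡⟨ cong (λ d → d ⊔ (n ∸ y)) (trans (cong (λ x → ∣ n - x ∣) x≡n) (∣n-n∣≡0 n)) ⟨
    ∣ n - x ∣ ⊔ (n ∸ y)     ≡⟨ e₁ ⟩
    ∣ n - x′ ∣ ⊔ (n ∸ y′)   ≡⟨ cong₂ (λ d y → d ⊔ (n ∸ y)) (m≤n⇒∣n-m∣≡n∸m (<⇒≤ x′<n)) y′≡n ⟩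
    (n ∸ x′) ⊔ (n ∸ n)      ≡⟨ cong ((n ∸ x′) ⊔_) (n∸n≡0 n) ⟩
    (n ∸ x′) ⊔ 0            ≡⟨ ⊔-identityʳ (n ∸ x′) ⟩
    n ∸ x′                  ∎)
    where open ≡-Reasoning

corner-pair-inner : ∀ {n x y x′ y′} → x < n → y ≤ n → x′ < n → y′ ≤ n →
  ∣ n - x ∣ ⊔ (n ∸ y) ≡ ∣ n - x′ ∣ ⊔ (n ∸ y′) → x ⊓ y ≡ x′ ⊓ y′
corner-pair-inner {n} {x} {y} {x′} {y′} x<n y≤n x′<n y′≤n e₁ =
  ∸-cancelˡ-≡ (≤-trans (m⊓n≤n x y) y≤n) (≤-trans (m⊓n≤n x′ y′) y′≤n) (begin
    n ∸ (x ⊓ y)           ≡⟨ ∸-distribˡ-⊓-⊔ n x y ⟩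
    (n ∸ x) ⊔ (n ∸ y)     ≡⟨ cong (_⊔ (n ∸ y)) (m≤n⇒∣n-m∣≡n∸m (<⇒≤ x<n)) ⟨
    ∣ n - x ∣ ⊔ (n ∸ y)   ≡⟨ e₁ ⟩
    ∣ n - x′ ∣ ⊔ (n ∸ y′) ≡⟨ cong (_⊔ (n ∸ y′)) (m≤n⇒∣n-m∣≡n∸m (<⇒≤ x′<n)) ⟩
    (n ∸ x′) ⊔ (n ∸ y′)   ≡⟨ ∸-distribˡ-⊓-⊔ n x′ y′ ⟨
    n ∸ (x′ ⊓ y′)         ∎)
  where open ≡-Reasoning

-- The distances from the corners (0, 0) and (n, n) of [0, ∞) × [0, n] determine (x, y) up to swapping.
corner-pair-determined : ∀ {n x y x′ y′} → y ≤ n → y′ ≤ n →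
  x ⊔ y ≡ x′ ⊔ y′ → ∣ n - x ∣ ⊔ (n ∸ y) ≡ ∣ n - x′ ∣ ⊔ (n ∸ y′) → x ≡ x′ ⊎ (x ≡ y′ × y ≡ x′)
corner-pair-determined {n} {x} {y} {x′} {y′} y≤n y′≤n e₀ e₁ with n ≤? x | n ≤? x′
... | yes n≤x | yes n≤x′ =
  inj₁ (trans (sym (m≥n⇒m⊔n≡m (≤-trans y≤n n≤x))) (trans e₀ (m≥n⇒m⊔n≡m (≤-trans y′≤n n≤x′))))
... | yes n≤x | no n≰x′ = inj₂ (corner-pair-mixed y≤n y′≤n n≤x (≰⇒> n≰x′) e₀ e₁)
... | no n≰x | yes n≤x′ with corner-pair-mixed y′≤n y≤n n≤x′ (≰⇒> n≰x) (sym e₀) (sym e₁)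
...   | x′≡y , y′≡x = inj₂ (sym y′≡x , sym x′≡y)
corner-pair-determined {n} {x} {y} {x′} {y′} y≤n y′≤n e₀ e₁ | no n≰x | no n≰x′ =
  ⊔-⊓-swap e₀ (corner-pair-inner (≰⇒> n≰x) y≤n (≰⇒> n≰x′) y′≤n e₁)

swapped-separated : ∀ {c x x′} → x < x′ → x′ ≤ c → ∣ c - x′ ∣ ⊔ x < ∣ c - x ∣ ⊔ x′
swapped-separated {c} {x} {x′} x<x′ x′≤c =
  subst₂ (λ a b → a ⊔ x < b ⊔ x′) (sym (m≤n⇒∣n-m∣≡n∸m x′≤c)) (sym (m≤n⇒∣n-m∣≡n∸m (≤-trans (<⇒≤ x<x′) x′≤c)))
    (⊔-mono-< (∸-monoʳ-< x<x′ x′≤c) x<x′)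

swapped-determined : ∀ {c x x′} → x ≤ c → x′ ≤ c → ∣ c - x ∣ ⊔ x′ ≡ ∣ c - x′ ∣ ⊔ x → x ≡ x′
swapped-determined {c} {x} {x′} x≤c x′≤c eq with <-cmp x x′
... | tri< x<x′ _ _ = contradiction (sym eq) (<⇒≢ (swapped-separated x<x′ x′≤c))
... | tri≈ _ x≡x′ _ = x≡x′
... | tri> _ _ x′<x = contradiction eq (<⇒≢ (swapped-separated x′<x x≤c))

-- A third landmark (c, 0) with c > n breaks the symmetry left by the two corners.
column-determined : ∀ {n c x y x′ y′} → y ≤ n → y′ ≤ n → n < c →
  x ⊔ y ≡ x′ ⊔ y′ → ∣ n - x ∣ ⊔ (n ∸ y) ≡ ∣ n - x′ ∣ ⊔ (n ∸ y′) → ∣ c - x ∣ ⊔ y ≡ ∣ c - x′ ∣ ⊔ y′ → x ≡ x′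
column-determined {n} {c} {x} {y} {x′} {y′} y≤n y′≤n n<c e₀ e₁ e₂ with corner-pair-determined y≤n y′≤n e₀ e₁
... | inj₁ x≡x′ = x≡x′
... | inj₂ (x≡y′ , y≡x′) =
  swapped-determined (≤-trans (≤-reflexive x≡y′) (≤-trans y′≤n (<⇒≤ n<c)))
                     (≤-trans (≤-reflexive (sym y≡x′)) (≤-trans y≤n (<⇒≤ n<c)))
                     (subst₂ (λ a b → ∣ c - x ∣ ⊔ a ≡ ∣ c - x′ ∣ ⊔ b) y≡x′ (sym x≡y′) e₂)

row-separated : ∀ {n h₁ h₂ y y′} → y < y′ → y′ ≤ n →
  h₁ ⊔ y ≡ h₁ ⊔ y′ → h₂ ⊔ (n ∸ y) ≡ h₂ ⊔ (n ∸ y′) → n < h₁ + h₂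
row-separated {n} {h₁} {h₂} {y} {y′} y<y′ y′≤n e₁ e₂ = begin-strict
  n             ≡⟨ m∸n+n≡m (≤-trans (<⇒≤ y<y′) y′≤n) ⟨
  (n ∸ y) + y   <⟨ +-monoʳ-< (n ∸ y) y<y′ ⟩
  (n ∸ y) + y′  ≤⟨ +-mono-≤ (⊔-<-absorbed (∸-monoʳ-< y<y′ y′≤n) (sym e₂)) (⊔-<-absorbed y<y′ e₁) ⟩
  h₂ + h₁       ≡⟨ +-comm h₂ h₁ ⟩
  h₁ + h₂       ∎
  where open ≤-Reasoning

row-determined : ∀ {n h₁ h₂ y y′} → h₁ + h₂ ≤ n → y ≤ n → y′ ≤ n →
  h₁ ⊔ y ≡ h₁ ⊔ y′ → h₂ ⊔ (n ∸ y) ≡ h₂ ⊔ (n ∸ y′) → y ≡ y′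
row-determined {y = y} {y′} h₁+h₂≤n y≤n y′≤n e₁ e₂ with <-cmp y y′
... | tri< y<y′ _ _ = contradiction h₁+h₂≤n (<⇒≱ (row-separated y<y′ y′≤n e₁ e₂))
... | tri≈ _ y≡y′ _ = y≡y′
... | tri> _ _ y′<y = contradiction h₁+h₂≤n (<⇒≱ (row-separated y′<y y≤n (sym e₁) (sym e₂)))

row-pair-determined : ∀ {n h₁ h₂ r₁ r₂ y y′} → (r₁ ≡ 0 × r₂ ≡ n) ⊎ (r₁ ≡ n × r₂ ≡ 0) →
  h₁ + h₂ ≤ n → y ≤ n → y′ ≤ n →
  h₁ ⊔ ∣ r₁ - y ∣ ≡ h₁ ⊔ ∣ r₁ - y′ ∣ → h₂ ⊔ ∣ r₂ - y ∣ ≡ h₂ ⊔ ∣ r₂ - y′ ∣ → y ≡ y′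
row-pair-determined {n} {h₁} {h₂} {y = y} {y′} (inj₁ (refl , refl)) h₁+h₂≤n y≤n y′≤n e₁ e₂ =
  row-determined h₁+h₂≤n y≤n y′≤n e₁
    (subst₂ (λ a b → h₂ ⊔ a ≡ h₂ ⊔ b) (m≤n⇒∣n-m∣≡n∸m y≤n) (m≤n⇒∣n-m∣≡n∸m y′≤n) e₂)
row-pair-determined {n} {h₁} {h₂} {y = y} {y′} (inj₂ (refl , refl)) h₁+h₂≤n y≤n y′≤n e₁ e₂ =
  row-determined (subst (_≤ n) (+-comm h₁ h₂) h₁+h₂≤n) y≤n y′≤n e₂
    (subst₂ (λ a b → h₁ ⊔ a ≡ h₁ ⊔ b) (m≤n⇒∣n-m∣≡n∸m y≤n) (m≤n⇒∣n-m∣≡n∸m y′≤n) e₁)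

∣c-x∣+∣c′-x∣≤n : ∀ {c x c′ n} → c ≤ x → x ≤ c′ → c′ ≤ c + n → ∣ c - x ∣ + ∣ c′ - x ∣ ≤ n
∣c-x∣+∣c′-x∣≤n {c} {x} {c′} {n} c≤x x≤c′ c′≤c+n = begin
  ∣ c - x ∣ + ∣ c′ - x ∣ ≡⟨ cong₂ _+_ (m≤n⇒∣m-n∣≡n∸m c≤x) (m≤n⇒∣n-m∣≡n∸m x≤c′) ⟩
  (x ∸ c) + (c′ ∸ x)     ≡⟨ +-comm (x ∸ c) _ ⟩
  (c′ ∸ x) + (x ∸ c)     ≡⟨ +-∸-assoc (c′ ∸ x) c≤x ⟨
  (c′ ∸ x) + x ∸ c       ≡⟨ cong (_∸ c) (m∸n+n≡m x≤c′) ⟩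
  c′ ∸ c                 ≤⟨ m≤n+o⇒m∸n≤o c′ c c′≤c+n ⟩
  n                      ∎
  where open ≤-Reasoning

bracket : ∀ (c : ℕ → ℕ) {x} K → c 0 ≤ x → x ≤ c (suc K) → ∃ λ j → j ≤ K × c j ≤ x × x ≤ c (suc j)
bracket c zero    c₀≤x x≤c₁ = 0 , z≤n , c₀≤x , x≤c₁
bracket c {x} (suc K) c₀≤x x≤cK with x ≤? c (suc K)
... | yes x≤c = let j , j≤K , rest = bracket c K c₀≤x x≤c in j , m≤n⇒m≤1+n j≤K , rest
... | no x≰c  = suc K , ≤-refl , <⇒≤ (≰⇒> x≰c) , x≤cK

module Landmarks (n′ L K : ℕ) ([K+1]n<L : suc K * suc n′ < L) (L≤[K+2]n : L ≤ suc (suc K) * suc n′) where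

  n : ℕ
  n = suc n′

  column : ℕ → ℕ
  column i = (i * n) ⊓ L

  row : ℕ → ℕ
  row zero          = 0
  row (suc zero)    = n
  row (suc (suc i)) = row i

  row≤n : ∀ i → row i ≤ n
  row≤n zero          = z≤n
  row≤n (suc zero)    = ≤-refl
  row≤n (suc (suc i)) = row≤n i

  row-alternates : ∀ i → (row i ≡ 0 × row (suc i) ≡ n) ⊎ (row i ≡ n × row (suc i) ≡ 0)
  row-alternates zero          = inj₁ (refl , refl)
  row-alternates (suc zero)    = inj₂ (refl , refl)
  row-alternates (suc (suc i)) = row-alternates i

  column-step≤ : ∀ j → column (suc j) ≤ column j + n
  column-step≤ j = begin
    (n + j * n) ⊓ L         ≤⟨ ⊓-mono-≤ (≤-reflexive (+-comm n (j * n))) (m≤m+n L n) ⟩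
    (j * n + n) ⊓ (L + n)   ≡⟨ +-distribʳ-⊓ n (j * n) L ⟨
    (j * n) ⊓ L + n         ∎
    where open ≤-Reasoning

  column≡L : column (suc (suc K)) ≡ L
  column≡L = m≥n⇒m⊓n≡n L≤[K+2]n

  column≡ : ∀ {i} → i ≤ suc K → column i ≡ i * n
  column≡ i≤K+1 = m≤n⇒m⊓n≡m (≤-trans (*-monoˡ-≤ n i≤K+1) (<⇒≤ [K+1]n<L))

  column-strict : ∀ {i j} → i < j → j ≤ suc (suc K) → column i < column j
  column-strict {i} {j} i<j j≤K+2 = begin-strict
    column i   ≡⟨ column≡ i≤K+1 ⟩
    i * n      <⟨ ⊓-glb (*-monoˡ-< n i<j) (≤-<-trans (*-monoˡ-≤ n i≤K+1) [K+1]n<L) ⟩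
    column j   ∎
    where
    open ≤-Reasoning
    i≤K+1 = s≤s⁻¹ (≤-trans i<j j≤K+2)

  landmark : Fin (suc (suc (suc K))) → Fin (suc L) × Fin (suc n)
  landmark i = fromℕ< (s≤s (m⊓n≤n (toℕ i * n) L)) , fromℕ< (s≤s (row≤n (toℕ i)))

  landmarks : List (Fin (suc L) × Fin (suc n))
  landmarks = tabulate landmark

  chebyshev-landmark : ∀ i (v : Fin (suc L) × Fin (suc n)) →
    chebyshev (landmark i) v ≡ ∣ column (toℕ i) - toℕ (proj₁ v) ∣ ⊔ ∣ row (toℕ i) - toℕ (proj₂ v) ∣
  chebyshev-landmark i (x , y) = cong₂ (λ a b → ∣ a - toℕ x ∣ ⊔ ∣ b - toℕ y ∣)
    (toℕ-fromℕ< (s≤s (m⊓n≤n (toℕ i * n) L))) (toℕ-fromℕ< (s≤s (row≤n (toℕ i))))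

  column-injective : ∀ {i j} → i ≤ suc (suc K) → j ≤ suc (suc K) → column i ≡ column j → i ≡ j
  column-injective {i} {j} i≤K+2 j≤K+2 eq with <-cmp i j
  ... | tri< i<j _ _ = contradiction eq (<⇒≢ (column-strict i<j j≤K+2))
  ... | tri≈ _ i≡j _ = i≡j
  ... | tri> _ _ j<i = contradiction (sym eq) (<⇒≢ (column-strict j<i i≤K+2))

  landmark-injective : ∀ {i j} → landmark i ≡ landmark j → i ≡ j
  landmark-injective {i} {j} eq = toℕ-injective (column-injective (s≤s⁻¹ (toℕ<n i)) (s≤s⁻¹ (toℕ<n j))
    (trans (sym (toℕ-fromℕ< _)) (trans (cong (toℕ ∘ proj₁) eq) (toℕ-fromℕ< _))))

  separating : ∀ v w → (∀ {s} → s ∈ landmarks → chebyshev s v ≡ chebyshev s w) → v ≡ w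
  separating (x , y) (x′ , y′) same = cong₂ _,_ (toℕ-injective X≡X′) (toℕ-injective Y≡Y′)
    where
    X = toℕ x
    Y = toℕ y
    X′ = toℕ x′
    Y′ = toℕ y′
    Y≤n  = s≤s⁻¹ (toℕ<n y)
    Y′≤n = s≤s⁻¹ (toℕ<n y′)
    same-at : ∀ i → i ≤ suc (suc K) → ∣ column i - X ∣ ⊔ ∣ row i - Y ∣ ≡ ∣ column i - X′ ∣ ⊔ ∣ row i - Y′ ∣
    same-at i i≤K+2 = subst (λ i → ∣ column i - X ∣ ⊔ ∣ row i - Y ∣ ≡ ∣ column i - X′ ∣ ⊔ ∣ row i - Y′ ∣)
      (toℕ-fromℕ< (s≤s i≤K+2))
      (trans (sym (chebyshev-landmark ι (x , y)))
        (trans (same (∈-tabulate⁺ {f = landmark} ι)) (chebyshev-landmark ι (x′ , y′))))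
      where ι = fromℕ< (s≤s i≤K+2)
    column₁≡n : column 1 ≡ n
    column₁≡n = trans (column≡ (s≤s z≤n)) (*-identityˡ n)
    X≡X′ : X ≡ X′
    X≡X′ = column-determined Y≤n Y′≤n (subst (_< column 2) column₁≡n (column-strict ≤-refl (s≤s (s≤s z≤n))))
      (same-at 0 z≤n)
      (subst₂ (λ c c′ → ∣ c - X ∣ ⊔ (n ∸ Y) ≡ ∣ c - X′ ∣ ⊔ (n ∸ Y′)) column₁≡n column₁≡n
        (subst₂ (λ a b → ∣ column 1 - X ∣ ⊔ a ≡ ∣ column 1 - X′ ∣ ⊔ b) (m≤n⇒∣n-m∣≡n∸m Y≤n) (m≤n⇒∣n-m∣≡n∸m Y′≤n)
          (same-at 1 (s≤s z≤n))))
      (same-at 2 (s≤s (s≤s z≤n)))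
    Y≡Y′ : Y ≡ Y′
    Y≡Y′ with bracket column (suc K) z≤n (subst (X ≤_) (sym column≡L) (s≤s⁻¹ (toℕ<n x)))
    ... | j , j≤K+1 , cⱼ≤X , X≤cⱼ₊₁ =
      row-pair-determined (row-alternates j) (∣c-x∣+∣c′-x∣≤n cⱼ≤X X≤cⱼ₊₁ (column-step≤ j)) Y≤n Y′≤n
        (at-column-X j (m≤n⇒m≤1+n j≤K+1)) (at-column-X (suc j) (s≤s j≤K+1))
      where
      at-column-X : ∀ i → i ≤ suc (suc K) → ∣ column i - X ∣ ⊔ ∣ row i - Y ∣ ≡ ∣ column i - X ∣ ⊔ ∣ row i - Y′ ∣
      at-column-X i i≤K+2 = subst (λ X′ → ∣ column i - X ∣ ⊔ ∣ row i - Y ∣ ≡ ∣ column i - X′ ∣ ⊔ ∣ row i - Y′ ∣)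
                              (sym X≡X′) (same-at i i≤K+2)

  metricDim : MetricDim (P (suc L) ⊠ P (suc n)) (suc (suc (suc K)))
  metricDim =
    (landmarks , tabulate⁺ landmark-injective , separating⇒generator landmarks separating , length-tabulate landmark) ,
    λ S _ gen → s≤s⁻¹ (*-cancelʳ-< n _ (suc (length S)) (begin-strict
      n + (n + suc K * n) <⟨ +-monoʳ-< n (+-monoʳ-< n [K+1]n<L) ⟩
      n + (n + L)         ≡⟨ cong (n +_) (+-comm n L) ⟩
      n + (L + n)         ≤⟨ +-monoʳ-≤ n (lower-bound gen) ⟩
      n + length S * n    ∎))
    where open ≤-Reasoning

L+n≤M*n⇒2<M : ∀ {L n′ M} → suc n′ < L → L + suc n′ ≤ M * suc n′ → 2 < M
L+n≤M*n⇒2<M {L} {n′} {M} n<L L+n≤M*n = *-cancelʳ-< n 2 M (begin-strict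
  n + (n + 0) ≡⟨ cong (n +_) (+-identityʳ n) ⟩
  n + n       <⟨ +-monoʳ-< n n<L ⟩
  n + L       ≡⟨ +-comm n L ⟩
  L + n       ≤⟨ L+n≤M*n ⟩
  M * n       ∎)
  where
  open ≤-Reasoning
  n = suc n′

metricDim-strongPath : ∀ {L n′ M} → suc n′ < L → L + suc n′ ≤ M * suc n′ × M * suc n′ < L + suc n′ + suc n′ →
                       MetricDim (P (suc L) ⊠ P (suc (suc n′))) M
metricDim-strongPath {L} {n′} {M} n<L (L+n≤M*n , M*n<L+2n) with L+n≤M*n⇒2<M {M = M} n<L L+n≤M*n
... | s≤s (s≤s (s≤s {n = K} _)) = Landmarks.metricDim n′ L K [K+1]n<L L≤[K+2]n
  where
  n = suc n′
  [K+1]n<L : suc K * n < L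
  [K+1]n<L = +-cancelˡ-< (n + n) _ L
    (subst₂ _<_ (sym (+-assoc n n (suc K * n))) (trans (+-assoc L n n) (+-comm L (n + n))) M*n<L+2n)
  L≤[K+2]n : L ≤ suc (suc K) * n
  L≤[K+2]n = +-cancelʳ-≤ n L _ (subst (L + n ≤_) (+-comm n _) L+n≤M*n)

⌈/⌉-bounds : ∀ a n′ → a ≤ ⌈ a / suc n′ ⌉ * suc n′ × ⌈ a / suc n′ ⌉ * suc n′ < a + suc n′
⌈/⌉-bounds a n′ = +-cancelʳ-≤ n′ a (q * n) a+n′≤q*n+n′ , ≤-<-trans (m/n*n≤m (a + n′) n) (+-monoʳ-< a (n<1+n n′))
  where
  n = suc n′
  q = (a + n′) / n
  a+n′≤q*n+n′ : a + n′ ≤ q * n + n′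
  a+n′≤q*n+n′ = begin
    a + n′               ≡⟨ m≡m%n+[m/n]*n (a + n′) n ⟩
    (a + n′) % n + q * n ≤⟨ +-monoˡ-≤ (q * n) (s≤s⁻¹ (m%n<n (a + n′) n)) ⟩
    n′ + q * n           ≡⟨ +-comm n′ (q * n) ⟩
    q * n + n′           ∎
    where open ≤-Reasoning

theorem19 : (t t' : ℕ) → (h : 2 ≤ t') → t' < t →
    MetricDim (P t ⊠ P t') (⌈ t + t' ∸ 2 / t' ∸ 1 ⌉ {{pred-nonZero h}})
theorem19 (suc L) (suc (suc n′)) (s≤s (s≤s z≤n)) (s≤s n<L) =
  subst (λ a → MetricDim (P (suc L) ⊠ P (suc (suc n′))) ⌈ a / suc n′ ⌉) (sym (cong (_∸ 1) (+-suc L (suc n′))))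
    (metricDim-strongPath n<L (⌈/⌉-bounds (L + suc n′) n′))
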